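{- Let $S=AB$ be a string over $\{0,1,2\}$ where $A$ ends with the digit $0$ and $B$ begins with a non-zero digit. Then $S$ splits as $A.B$, i.e. $S_n=A_nB_n$ for all $n\ge 0$.
   Context: A run is a maximal block of consecutive equal digits. The base-3 look-and-say operation sends a string $A$, written as its runs $r_1\cdots r_k$ with $r_i$ consisting of $n_i$ copies of the digit $d_i$, to the string $A_1$ obtained by replacing each $r_i$ by the base-3 representation of $n_i$ (no leading zeros) followed by $d_i$, and concatenating; $A_0=A$, $A_{n+1}=(A_n)_1$. -}

module Defs where

open import Data.Nat using (ℕ; zero; suc)
open import Data.Nat.DivMod using (_/_; _%_; m%n<n)
open import Data.Fin using (Fin; zero; suc; fromℕ<)
open import Data.Fin.Properties using (_≟_)
open import Data.List using (List; []; _∷_; _++_; concatMap; reverse)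
open import Data.Product using (_×_; _,_)
open import Relation.Nullary using (yes; no)
open import Function using (_∘_)

Digit : Set
Digit = Fin 3

Str : Set
Str = List Digit

-- run-length decomposition: list of (length n_i , digit d_i), n_i ≥ 1
consRun : Digit → List (ℕ × Digit) → List (ℕ × Digit)
consRun d [] = (1 , d) ∷ []
consRun d ((n , e) ∷ rs) with d ≟ e
... | yes _ = (suc n , e) ∷ rs
... | no _  = (1 , d) ∷ (n , e) ∷ rs

runs : Str → List (ℕ × Digit)
runs [] = []
runs (d ∷ xs) = consRun d (runs xs)

digitsLSB : ℕ → ℕ → Str
digitsLSB zero    _       = []
digitsLSB (suc f) zero    = []
digitsLSB (suc f) (suc m) =
  fromℕ< (m%n<n (suc m) 3) ∷ digitsLSB f (suc m / 3)

-- base-3 representation of n (no leading zeros; empty for n = 0, never used)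
base3 : ℕ → Str
base3 n = reverse (digitsLSB n n)

lookSay : Str → Str
lookSay s = concatMap (λ { (n , d) → base3 n ++ (d ∷ []) }) (runs s)

iter : ℕ → Str → Str
iter zero    s = s
iter (suc n) s = lookSay (iter n s)

{-# OPTIONS --safe #-}
-- The runs of A and B cannot merge, because A ends in 0 and B starts with a
-- non-zero digit, so one look-and-say step acts on A and on B separately.
-- Both boundary conditions are invariant: a run is coded by its length followed
-- by its digit, so A₁ again ends in 0, and a length is written without leading
-- zeros, so B₁ again starts with a non-zero digit.
module Submission where

open import Defs
open import Data.Nat using (ℕ; zero; suc; _<_; s≤s; s≤s⁻¹; z≤n)
open import Data.Nat.Properties using (≤-refl; ≤-trans)
open import Data.Nat.DivMod using (_/_; m%n<n; m/n<m; m/n≡0⇒m<n; m<n⇒m%n≡m)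
open import Data.Fin using (zero; toℕ; fromℕ<)
open import Data.Fin.Properties using (_≟_; toℕ-fromℕ<)
open import Data.List using ([]; _∷_; _++_; concatMap; reverse)
open import Data.List.Properties
  using (concatMap-++; concatMap-cong; reverse-++; ++-assoc; ++-identityʳ; ++-conicalʳ)
open import Data.Product using (_×_; _,_; ∃-syntax; ∃₂)
open import Relation.Nullary using (yes; no; contradiction)
open import Relation.Binary.PropositionalEquality
  using (_≡_; _≢_; refl; sym; trans; cong; cong₂; subst; ≢-sym; module ≡-Reasoning)
open ≡-Reasoning

EndsWith : Digit → Str → Set
EndsWith a s = ∃[ s′ ] s ≡ s′ ++ a ∷ []

StartsWith : Digit → Str → Set
StartsWith b s = ∃[ s′ ] s ≡ b ∷ s′

StartsNonzero : Str → Set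
StartsNonzero s = ∃[ b ] b ≢ zero × StartsWith b s

consRun-head : ∀ d rs → ∃₂ λ n rs′ → consRun d rs ≡ (suc n , d) ∷ rs′
consRun-head d [] = 0 , [] , refl
consRun-head d ((n , e) ∷ rs) with d ≟ e
... | yes refl = n , rs , refl
... | no _     = 0 , (n , e) ∷ rs , refl

consRun-≢ : ∀ {d e} n rs → d ≢ e → consRun d ((n , e) ∷ rs) ≡ (1 , d) ∷ (n , e) ∷ rs
consRun-≢ {d} {e} n rs d≢e with d ≟ e
... | yes d≡e = contradiction d≡e d≢e
... | no _    = refl

consRun-++ : ∀ d {rs} R → rs ≢ [] → consRun d (rs ++ R) ≡ consRun d rs ++ R
consRun-++ d {[]} R rs≢[] = contradiction refl rs≢[]
consRun-++ d {(n , e) ∷ rs} R _ with d ≟ e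
... | yes _ = refl
... | no _  = refl

consRun-∷ʳ : ∀ d rs n a → ∃₂ λ rs′ n′ → consRun d (rs ++ (n , a) ∷ []) ≡ rs′ ++ (n′ , a) ∷ []
consRun-∷ʳ d [] n a with d ≟ a
... | yes refl = [] , suc n , refl
... | no _     = (1 , d) ∷ [] , n , refl
consRun-∷ʳ d rs@(_ ∷ _) n a = consRun d rs , n , consRun-++ d {rs} _ λ ()

runs-∷ʳ : ∀ A′ a → ∃₂ λ rs n → runs (A′ ++ a ∷ []) ≡ rs ++ (n , a) ∷ []
runs-∷ʳ [] a = [] , 1 , refl
runs-∷ʳ (x ∷ A′) a =
  let rs , n , eq = runs-∷ʳ A′ a
      rs′ , n′ , eq′ = consRun-∷ʳ x rs n a
  in rs′ , n′ , trans (cong (consRun x) eq) eq′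

runs-∷ʳ-≢[] : ∀ A′ a → runs (A′ ++ a ∷ []) ≢ []
runs-∷ʳ-≢[] A′ a runs≡[] with runs-∷ʳ A′ a
... | rs , _ , eq with ++-conicalʳ rs _ (trans (sym eq) runs≡[])
... | ()

runs-++ : ∀ A′ {a b} B′ → a ≢ b →
  runs ((A′ ++ a ∷ []) ++ b ∷ B′) ≡ runs (A′ ++ a ∷ []) ++ runs (b ∷ B′)
runs-++ [] {a} {b} B′ a≢b =
  let n , rs , eq = consRun-head b (runs B′)
  in begin
    consRun a (runs (b ∷ B′))      ≡⟨ cong (consRun a) eq ⟩
    consRun a ((suc n , b) ∷ rs)   ≡⟨ consRun-≢ (suc n) rs a≢b ⟩
    (1 , a) ∷ (suc n , b) ∷ rs     ≡⟨ cong ((1 , a) ∷_) (sym eq) ⟩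
    (1 , a) ∷ runs (b ∷ B′)        ∎
runs-++ (x ∷ A′) {a} {b} B′ a≢b = begin
  consRun x (runs ((A′ ++ a ∷ []) ++ b ∷ B′))        ≡⟨ cong (consRun x) (runs-++ A′ B′ a≢b) ⟩
  consRun x (runs (A′ ++ a ∷ []) ++ runs (b ∷ B′))   ≡⟨ consRun-++ x _ (runs-∷ʳ-≢[] A′ a) ⟩
  consRun x (runs (A′ ++ a ∷ [])) ++ runs (b ∷ B′)   ∎

encodeRun : ℕ × Digit → Str
encodeRun (n , d) = base3 n ++ d ∷ []

lookSay-runs : ∀ s → lookSay s ≡ concatMap encodeRun (runs s)
lookSay-runs s = concatMap-cong (λ { (n , d) → refl }) (runs s)

lookSay-++ : ∀ {a b A B} → EndsWith a A → StartsWith b B → a ≢ b →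
  lookSay (A ++ B) ≡ lookSay A ++ lookSay B
lookSay-++ {a} {b} {A} {B} (A′ , refl) (B′ , refl) a≢b = begin
  lookSay (A ++ B)                                          ≡⟨ lookSay-runs (A ++ B) ⟩
  concatMap encodeRun (runs (A ++ B))                       ≡⟨ cong (concatMap encodeRun) (runs-++ A′ B′ a≢b) ⟩
  concatMap encodeRun (runs A ++ runs B)                    ≡⟨ concatMap-++ encodeRun (runs A) (runs B) ⟩
  concatMap encodeRun (runs A) ++ concatMap encodeRun (runs B)
    ≡⟨ sym (cong₂ _++_ (lookSay-runs A) (lookSay-runs B)) ⟩
  lookSay A ++ lookSay B                                    ∎

lookSay-endsWith : ∀ {a A} → EndsWith a A → EndsWith a (lookSay A)
lookSay-endsWith {a} (A′ , refl) =
  let rs , n , eq = runs-∷ʳ A′ a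
      prefix = concatMap encodeRun rs
  in prefix ++ base3 n , (begin
    lookSay (A′ ++ a ∷ [])                      ≡⟨ lookSay-runs (A′ ++ a ∷ []) ⟩
    concatMap encodeRun (runs (A′ ++ a ∷ []))   ≡⟨ cong (concatMap encodeRun) eq ⟩
    concatMap encodeRun (rs ++ (n , a) ∷ [])    ≡⟨ concatMap-++ encodeRun rs _ ⟩
    prefix ++ (base3 n ++ a ∷ []) ++ []         ≡⟨ cong (prefix ++_) (++-identityʳ _) ⟩
    prefix ++ base3 n ++ a ∷ []                 ≡⟨ ++-assoc prefix (base3 n) _ ⟨
    (prefix ++ base3 n) ++ a ∷ []               ∎)

digitsLSB-zero : ∀ f → digitsLSB f 0 ≡ []
digitsLSB-zero zero    = refl
digitsLSB-zero (suc f) = refl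

-- Digits come least significant first, so this is the absence of leading zeros.
digitsLSB-last : ∀ {f} m → m < f → ∃₂ λ ds d → d ≢ zero × digitsLSB f (suc m) ≡ ds ++ d ∷ []
digitsLSB-last {suc f} m (s≤s m≤f) with suc m / 3 in q
... | zero  = [] , _ , leading≢0 , cong (_ ∷_) (digitsLSB-zero f)
  where
  leading≢0 : fromℕ< (m%n<n (suc m) 3) ≢ zero
  leading≢0 eq with trans (sym (cong toℕ eq)) (trans (toℕ-fromℕ< (m%n<n (suc m) 3)) (m<n⇒m%n≡m (m/n≡0⇒m<n {suc m} {3} q)))
  ... | ()
... | suc k =
  let ds , d , d≢0 , eq = digitsLSB-last k (≤-trans (s≤s⁻¹ k+1<m+1) m≤f)
  in _ ∷ ds , d , d≢0 , cong (_ ∷_) eq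
  where
  k+1<m+1 : suc k < suc m
  k+1<m+1 = subst (_< suc m) q (m/n<m (suc m) 3 (s≤s (s≤s z≤n)))

base3-head : ∀ m → ∃₂ λ d ds → d ≢ zero × base3 (suc m) ≡ d ∷ ds
base3-head m =
  let ds , d , d≢0 , eq = digitsLSB-last {suc m} m ≤-refl
  in d , reverse ds , d≢0 , trans (cong reverse eq) (reverse-++ ds (d ∷ []))

lookSay-startsNonzero : ∀ {b B} → StartsWith b B → StartsNonzero (lookSay B)
lookSay-startsNonzero {b} (B′ , refl) =
  let n , rs , eq = consRun-head b (runs B′)
      d , ds , d≢0 , eq′ = base3-head n
      suffix = concatMap encodeRun rs
  in d , d≢0 , (ds ++ b ∷ []) ++ suffix , (begin
    lookSay (b ∷ B′)                              ≡⟨ lookSay-runs (b ∷ B′) ⟩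
    concatMap encodeRun (consRun b (runs B′))     ≡⟨ cong (concatMap encodeRun) eq ⟩
    (base3 (suc n) ++ b ∷ []) ++ suffix           ≡⟨ cong (λ s → (s ++ b ∷ []) ++ suffix) eq′ ⟩
    d ∷ (ds ++ b ∷ []) ++ suffix                  ∎)

iter-endsWith : ∀ n {a A} → EndsWith a A → EndsWith a (iter n A)
iter-endsWith zero    A-ends = A-ends
iter-endsWith (suc n) A-ends = lookSay-endsWith (iter-endsWith n A-ends)

iter-startsNonzero : ∀ n {B} → StartsNonzero B → StartsNonzero (iter n B)
iter-startsNonzero zero    B-starts = B-starts
iter-startsNonzero (suc n) B-starts =
  let _ , _ , Bₙ-starts = iter-startsNonzero n B-starts
  in lookSay-startsNonzero Bₙ-starts

lemma1 : (A' B' : Str) (b : Digit) → b ≢ zero →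
    let A = A' ++ (zero ∷ [])
        B = b ∷ B'
    in (n : ℕ) → iter n (A ++ B) ≡ iter n A ++ iter n B
lemma1 A' B' b b≢0 zero = refl
lemma1 A' B' b b≢0 (suc n) =
  let A = A' ++ zero ∷ []
      B = b ∷ B'
      c , c≢0 , Bₙ-starts = iter-startsNonzero n (b , b≢0 , B' , refl)
  in begin
    lookSay (iter n (A ++ B))          ≡⟨ cong lookSay (lemma1 A' B' b b≢0 n) ⟩
    lookSay (iter n A ++ iter n B)     ≡⟨ lookSay-++ (iter-endsWith n (A' , refl)) Bₙ-starts (≢-sym c≢0) ⟩
    lookSay (iter n A) ++ lookSay (iter n B) ∎
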